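{- Let $t_1<t_2<\cdots$ be the remaining samples. If there is a removed sample $l_j$ and consecutive remaining samples $t_i,t_{i+1}$ with $t_i<l_j<t_{i+1}$, then $t_{i+1}-t_i\le s$.
   Context: Let $l_1<l_2<\dots<l_r$ be integers (the samples; in the paper, the text positions of the last letters of the runs of the Burrows–Wheeler transform of a text). Subsampling with integer parameter $s\ge1$: for $i=2,3,\dots,r-1$ in this order, remove $l_i$ if $l_{i+1}-l'\le s$, where $l'$ is the largest not-removed sample among $l_1,\dots,l_{i-1}$. The samples not removed ($l_1$ and $l_r$ always among them) are the remaining samples, listed in increasing order as $t_1<t_2<\cdots$; the others are removed samples. -}

module Defs where

open import Data.Bool using (Bool; true; false; if_then_else_)
open import Data.Integer using (ℤ; _-_; _≤?_)
open import Data.List using (List; []; _∷_; zip; map; filter; length)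
open import Data.Product using (_×_; _,_; proj₁)
open import Relation.Nullary.Decidable using (does)
open import Data.Bool using (T; T?)

-- Subsampling. `go s l' xs` processes samples xs = l_i ∷ l_{i+1} ∷ …
-- where l' is the largest not-removed sample so far; it returns, for each
-- element of xs, whether it is kept (true) or removed (false).
go : ℤ → ℤ → List ℤ → List Bool
go s l' [] = []
go s l' (x ∷ []) = true ∷ []
go s l' (x ∷ y ∷ rest) =
  if does ((y - l') ≤? s)
  then false ∷ go s l' (y ∷ rest)
  else true ∷ go s x (y ∷ rest)

keepFlags : ℤ → List ℤ → List Bool
keepFlags s [] = []
keepFlags s (x ∷ xs) = true ∷ go s x xs

flagged : ℤ → List ℤ → List (ℤ × Bool)
flagged s ls = zip ls (keepFlags s ls)

isKept : ℤ × Bool → Bool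
isKept (_ , b) = b

isRemoved : ℤ × Bool → Bool
isRemoved (_ , true) = false
isRemoved (_ , false) = true

remaining : ℤ → List ℤ → List ℤ
remaining s ls = map proj₁ (filter (λ p → T? (isKept p)) (flagged s ls))

removed : ℤ → List ℤ → List ℤ
removed s ls = map proj₁ (filter (λ p → T? (isRemoved p)) (flagged s ls))

-- Let a < b be consecutive remaining samples with a removed sample between
-- them, and let c be the last sample before b (a removed one, since c ≥ the
-- removed sample > a).  Every sample strictly between a and b is removed, so
-- while they are processed the largest remaining sample so far stays a; in
-- particular c was removed because of the test b − a ≤ s.
module Submission where

open import Defs
open import Data.Bool using (T?)
open import Data.Fin using (fromℕ<)
open import Data.Integer using (ℤ; _-_; _≤_; _<_; +_)
import Data.Integer as ℤ
open import Data.Integer.Properties using (<-trans; <-asym)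
open import Data.List using (List; []; _∷_; length; lookup; map; filter; zip)
open import Data.List.Membership.Propositional using (_∈_)
open import Data.List.Membership.Propositional.Properties using (∈-map⁻; ∈-filter⁻)
open import Data.List.Relation.Unary.All as All using ()
open import Data.List.Relation.Unary.AllPairs using (_∷_)
open import Data.List.Relation.Unary.Any using (here; there)
open import Data.List.Relation.Unary.Linked as Linked using (Linked; _∷_)
open import Data.List.Relation.Unary.Linked.Properties using (Linked⇒AllPairs)
open import Data.Nat as ℕ using (ℕ; zero; suc; s≤s)
open import Data.Product using (Σ-syntax; _×_; _,_; proj₁)
open import Data.Sum using (_⊎_; inj₁; inj₂)
open import Data.Empty using (⊥-elim)
open import Relation.Nullary using (yes; no)
open import Relation.Unary using (Pred; Decidable)
open import Relation.Binary.PropositionalEquality using (_≡_; refl)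

private
  variable
    A B : Set
    a b x : A
    xs : List A

∈-zip⇒proj₁∈ : {p : A × B} {ys : List B} → p ∈ zip xs ys → proj₁ p ∈ xs
∈-zip⇒proj₁∈ {xs = _ ∷ _} {ys = _ ∷ _} (here refl) = here refl
∈-zip⇒proj₁∈ {xs = _ ∷ _} {ys = _ ∷ _} (there p∈) = there (∈-zip⇒proj₁∈ p∈)

∈-map-proj₁-filter-zip⁻ : ∀ {p} {P : Pred (A × B) p} (P? : Decidable P) {ys : List B} →
  a ∈ map proj₁ (filter P? (zip xs ys)) → a ∈ xs
∈-map-proj₁-filter-zip⁻ P? a∈ with ∈-map⁻ proj₁ a∈
... | _ , p∈ , refl = ∈-zip⇒proj₁∈ (proj₁ (∈-filter⁻ P? p∈))

head<∈tail : Linked _<_ (x ∷ xs) → a ∈ xs → x < a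
head<∈tail increasing with Linked⇒AllPairs <-trans increasing
... | x<xs ∷ _ = All.lookup x<xs

data Consecutive (a b : A) : List A → Set where
  here  : Consecutive a b (a ∷ b ∷ xs)
  there : Consecutive a b xs → Consecutive a b (x ∷ xs)

Consecutive⇒∈ : Consecutive a b xs → a ∈ xs
Consecutive⇒∈ here      = here refl
Consecutive⇒∈ (there c) = there (Consecutive⇒∈ c)

Consecutive-∷⁻ : Consecutive a b (x ∷ xs) →
  (a ≡ x × Σ[ ys ∈ List A ] xs ≡ b ∷ ys) ⊎ Consecutive a b xs
Consecutive-∷⁻ here      = inj₁ (refl , _ , refl)
Consecutive-∷⁻ (there c) = inj₂ c

Consecutive-lookup : (xs : List A) (i : ℕ)
  (h₁ : i ℕ.< length xs) (h₂ : suc i ℕ.< length xs) →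
  Consecutive (lookup xs (fromℕ< h₁)) (lookup xs (fromℕ< h₂)) xs
Consecutive-lookup (_ ∷ _ ∷ _) zero    _        (s≤s (s≤s _)) = here
Consecutive-lookup (_ ∷ xs)    (suc i) (s≤s h₁) (s≤s h₂)      = there (Consecutive-lookup xs i h₁ h₂)

keptFrom : ℤ → ℤ → List ℤ → List ℤ
keptFrom s l' xs = map proj₁ (filter (λ p → T? (isKept p)) (zip xs (go s l' xs)))

removedFrom : ℤ → ℤ → List ℤ → List ℤ
removedFrom s l' xs = map proj₁ (filter (λ p → T? (isRemoved p)) (zip xs (go s l' xs)))

keptFrom⊆ : ∀ {s l'} → a ∈ keptFrom s l' xs → a ∈ xs
keptFrom⊆ = ∈-map-proj₁-filter-zip⁻ (λ p → T? (isKept p))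

removedFrom⊆ : ∀ {s l'} → a ∈ removedFrom s l' xs → a ∈ xs
removedFrom⊆ = ∈-map-proj₁-filter-zip⁻ (λ p → T? (isRemoved p))

-- Either y is kept, or it is removed because its successor is within s of
-- l', and then the same holds from that successor on.
head-keptFrom-within : ∀ s l' y ys {b bs} → y - l' ≤ s →
  keptFrom s l' (y ∷ ys) ≡ b ∷ bs → b - l' ≤ s
head-keptFrom-within s l' y []       y-l'≤s refl = y-l'≤s
head-keptFrom-within s l' y (z ∷ zs) y-l'≤s eq with (z - l') ℤ.≤? s
... | yes z-l'≤s = head-keptFrom-within s l' z zs z-l'≤s eq
... | no _ with eq
...   | refl = y-l'≤s

gap-over-removed : ∀ s l' ys {a b d} → Linked _<_ ys →
  Consecutive a b (l' ∷ keptFrom s l' ys) → d ∈ removedFrom s l' ys →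
  a < d → d < b → b - a ≤ s
gap-over-removed s l' []            _ (there ()) _
gap-over-removed s l' (x ∷ [])      _ _          ()
gap-over-removed s l' (x ∷ y ∷ ys) increasing c d∈ a<d d<b with (y - l') ℤ.≤? s
... | no _ with c
...   | here     = ⊥-elim (<-asym d<b (head<∈tail increasing (removedFrom⊆ d∈)))
...   | there c′ = gap-over-removed s x (y ∷ ys) (Linked.tail increasing) c′ d∈ a<d d<b
gap-over-removed s l' (x ∷ y ∷ ys) increasing c (there d∈) a<d d<b | yes _ =
  gap-over-removed s l' (y ∷ ys) (Linked.tail increasing) c d∈ a<d d<b
gap-over-removed s l' (x ∷ y ∷ ys) increasing c (here refl) a<x _ | yes y-l'≤s
  with Consecutive-∷⁻ c
... | inj₁ (refl , _ , eq) = head-keptFrom-within s l' y ys y-l'≤s eq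
... | inj₂ c′ = ⊥-elim (<-asym a<x (head<∈tail increasing (keptFrom⊆ (Consecutive⇒∈ c′))))

lemma5p2 : (s : ℤ) → (+ 1) ≤ s → (ls : List ℤ) → Linked _<_ ls →
    (lj : ℤ) → lj ∈ removed s ls →
    (i : ℕ) → (h₁ : i ℕ.< length (remaining s ls)) → (h₂ : suc i ℕ.< length (remaining s ls)) →
    lookup (remaining s ls) (fromℕ< h₁) < lj →
    lj < lookup (remaining s ls) (fromℕ< h₂) →
    lookup (remaining s ls) (fromℕ< h₂) - lookup (remaining s ls) (fromℕ< h₁) ≤ s
-- By computation, remaining s (l₁ ∷ ls)
-- is l₁ ∷ keptFrom s l₁ ls and removed s (l₁ ∷ ls) is removedFrom s l₁ ls.
lemma5p2 s _ (l₁ ∷ ls) increasing lj lj∈ i h₁ h₂ =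
  gap-over-removed s l₁ ls (Linked.tail increasing)
    (Consecutive-lookup (l₁ ∷ keptFrom s l₁ ls) i h₁ h₂) lj∈
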